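{- If $p$ and $p'$ are $\mathrm{PA}^*_{01}$ expressions such that $p\to^+ p'$, then $\mathrm{OC}(p)\ge\mathrm{OC}(p')$. Moreover, if $\mathrm{OC}(p)=\mathrm{OC}(p')$, then either $p=p_1\cdot q$ and $p'=p_1'\cdot q$, or $p=p_1\parallel p_2$ and $p'=p_1'\parallel p_2'$, for some expressions $p_1,p_2,p_1',p_2',q$.
   Context: Fix a non-empty set $A$ of actions. $\mathrm{PA}^*_{01}$ expressions are generated by $p ::= \mathbf{0} \mid \mathbf{1} \mid a \mid p\cdot p \mid p+p \mid p^* \mid p\parallel p$ with $a\in A$ (equality is syntactic identity). The transition relation $p\xrightarrow{a}p'$ and termination predicate $p\downarrow$ are the least relations such that: $\mathbf{1}\downarrow$; $a\xrightarrow{a}\mathbf{1}$; if $p\xrightarrow{a}p'$ then $p+q\xrightarrow{a}p'$ and $q+p\xrightarrow{a}p'$; if $p\downarrow$ then $(p+q)\downarrow$ and $(q+p)\downarrow$; if $p\xrightarrow{a}p'$ then $p\cdot q\xrightarrow{a}p'\cdot q$; if $p\downarrow$ and $q\xrightarrow{a}q'$ then $p\cdot q\xrightarrow{a}q'$; if $p\downarrow$ and $q\downarrow$ then $(p\cdot q)\downarrow$; if $p\xrightarrow{a}p'$ then $p^*\xrightarrow{a}p'\cdot p^*$; $p^*\downarrow$; if $p\xrightarrow{a}p'$ then $p\parallel q\xrightarrow{a}p'\parallel q$; if $q\xrightarrow{a}q'$ then $p\parallel q\xrightarrow{a}p\parallel q'$; if $p\downarrow$ and $q\downarrow$ then $(p\parallel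 q)\downarrow$. $p\to q$ means $p\xrightarrow{a}q$ for some $a$, and $\to^+$ is its transitive closure. The measure $\mathrm{OC}$ is defined by structural recursion: $\mathrm{OC}(\mathbf{0})=\mathrm{OC}(\mathbf{1})=0$, $\mathrm{OC}(a)=1$; $\mathrm{OC}(p\cdot q)=0$ if $q$ is a star expression (of the form $r^*$) and $\mathrm{OC}(p\cdot q)=\mathrm{OC}(q)+1$ otherwise; $\mathrm{OC}(p+q)=\max(\mathrm{OC}(p),\mathrm{OC}(q))+1$; $\mathrm{OC}(p^*)=1$; $\mathrm{OC}(p\parallel q)=0$. -}

module Defs where

open import Data.Nat using (ℕ; zero; suc; _⊔_)

data Exp (A : Set) : Set where
  𝟘 𝟙 : Exp A
  act : A → Exp A
  _·_ : Exp A → Exp A → Exp A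
  _⊕_ : Exp A → Exp A → Exp A
  _*  : Exp A → Exp A
  _∥_ : Exp A → Exp A → Exp A

module _ {A : Set} where

  data _↓ : Exp A → Set
  data _─[_]→_ : Exp A → A → Exp A → Set

  data _↓ where
    𝟙↓  : 𝟙 ↓
    ⊕↓ˡ : ∀ {p q} → p ↓ → (p ⊕ q) ↓
    ⊕↓ʳ : ∀ {p q} → q ↓ → (p ⊕ q) ↓
    ·↓  : ∀ {p q} → p ↓ → q ↓ → (p · q) ↓
    *↓  : ∀ {p} → (p *) ↓
    ∥↓  : ∀ {p q} → p ↓ → q ↓ → (p ∥ q) ↓

  data _─[_]→_ where
    act→ : ∀ {a} → act a ─[ a ]→ 𝟙
    ⊕→ˡ  : ∀ {p q a p'} → p ─[ a ]→ p' → (p ⊕ q) ─[ a ]→ p'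
    ⊕→ʳ  : ∀ {p q a p'} → p ─[ a ]→ p' → (q ⊕ p) ─[ a ]→ p'
    ·→ˡ  : ∀ {p q a p'} → p ─[ a ]→ p' → (p · q) ─[ a ]→ (p' · q)
    ·→ʳ  : ∀ {p q a q'} → p ↓ → q ─[ a ]→ q' → (p · q) ─[ a ]→ q'
    *→   : ∀ {p a p'} → p ─[ a ]→ p' → (p *) ─[ a ]→ (p' · (p *))
    ∥→ˡ  : ∀ {p q a p'} → p ─[ a ]→ p' → (p ∥ q) ─[ a ]→ (p' ∥ q)
    ∥→ʳ  : ∀ {p q a q'} → q ─[ a ]→ q' → (p ∥ q) ─[ a ]→ (p ∥ q')

  data _⟶_ (p q : Exp A) : Set where
    step : ∀ {a} → p ─[ a ]→ q → p ⟶ q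

  data _⟶⁺_ : Exp A → Exp A → Set where
    [_]  : ∀ {p q} → p ⟶ q → p ⟶⁺ q
    _∷_  : ∀ {p q r} → p ⟶ q → q ⟶⁺ r → p ⟶⁺ r

  OC : Exp A → ℕ
  OC 𝟘 = 0
  OC 𝟙 = 0
  OC (act a) = 1
  OC (p · (r *)) = 0
  OC (p · 𝟘) = suc (OC 𝟘)
  OC (p · 𝟙) = suc (OC 𝟙)
  OC (p · act a) = suc (OC (act a))
  OC (p · (q · r)) = suc (OC (q · r))
  OC (p · (q ⊕ r)) = suc (OC (q ⊕ r))
  OC (p · (q ∥ r)) = suc (OC (q ∥ r))
  OC (p ⊕ q) = suc (OC p ⊔ OC q)
  OC (p *) = 1
  OC (p ∥ q) = 0

-- OC (p · q) depends only on q, and exceeds OC q unless q is a star. Hence a step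
-- either strictly lowers OC, or it happens inside the left factor of p · q, inside a
-- parallel composition, or unfolds the star q = r * of p · q (where OC stays 0).
-- In the non-decreasing cases source and target share the frame p · q / p' · q or
-- p₁ ∥ p₂ / p₁' ∥ p₂', and such frames compose along a path.
module Submission where

open import Defs
open import Data.Nat using (suc; _<_; _≥_; z≤n; s≤s)
open import Data.Nat.Properties using (≤-reflexive; <⇒≤; <-trans; <-irrefl; m≤m⊔n; m≤n⊔m; ≤-trans)
open import Data.Product using (Σ-syntax; ∃-syntax; _×_; _,_)
open import Data.Sum using (_⊎_; inj₁; inj₂)
open import Data.Empty using (⊥-elim)
open import Relation.Binary.PropositionalEquality using (_≡_; refl; sym; trans; subst)

module _ {A : Set} where

  data SameFrame : Exp A → Exp A → Set where
    ·-frame : ∀ {p₁ p₁' q} → SameFrame (p₁ · q) (p₁' · q)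
    ∥-frame : ∀ {p₁ p₂ p₁' p₂'} → SameFrame (p₁ ∥ p₂) (p₁' ∥ p₂')

  SameFrame-trans : ∀ {p q r} → SameFrame p q → SameFrame q r → SameFrame p r
  SameFrame-trans ·-frame ·-frame = ·-frame
  SameFrame-trans ∥-frame ∥-frame = ∥-frame

  Descent : Exp A → Exp A → Set
  Descent p p' = OC p' < OC p ⊎ (OC p ≡ OC p' × SameFrame p p')

  Descent-trans : ∀ {p q r} → Descent p q → Descent q r → Descent p r
  Descent-trans (inj₁ q<p) (inj₁ r<q) = inj₁ (<-trans r<q q<p)
  Descent-trans {p} (inj₁ q<p) (inj₂ (q≡r , _)) = inj₁ (subst (_< OC p) q≡r q<p)
  Descent-trans {r = r} (inj₂ (p≡q , _)) (inj₁ r<q) = inj₁ (subst (OC r <_) (sym p≡q) r<q)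
  Descent-trans (inj₂ (p≡q , s)) (inj₂ (q≡r , s')) = inj₂ (trans p≡q q≡r , SameFrame-trans s s')

  Descent⇒OC-≥ : ∀ {p p'} → Descent p p' → OC p ≥ OC p'
  Descent⇒OC-≥ (inj₁ p'<p) = <⇒≤ p'<p
  Descent⇒OC-≥ (inj₂ (p≡p' , _)) = ≤-reflexive (sym p≡p')

  Descent-OC-≡⇒SameFrame : ∀ {p p'} → Descent p p' → OC p ≡ OC p' → SameFrame p p'
  Descent-OC-≡⇒SameFrame (inj₁ p'<p) p≡p' = ⊥-elim (<-irrefl (sym p≡p') p'<p)
  Descent-OC-≡⇒SameFrame (inj₂ (_ , s)) _ = s

  OC-·-star-or-suc : ∀ (p q : Exp A) → (Σ[ r ∈ Exp A ] q ≡ r *) ⊎ OC (p · q) ≡ suc (OC q)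
  OC-·-star-or-suc p 𝟘 = inj₂ refl
  OC-·-star-or-suc p 𝟙 = inj₂ refl
  OC-·-star-or-suc p (act a) = inj₂ refl
  OC-·-star-or-suc p (q · r) = inj₂ refl
  OC-·-star-or-suc p (q ⊕ r) = inj₂ refl
  OC-·-star-or-suc p (r *) = inj₁ (r , refl)
  OC-·-star-or-suc p (q ∥ r) = inj₂ refl

  OC-·-independentˡ : ∀ (p p' q : Exp A) → OC (p · q) ≡ OC (p' · q)
  OC-·-independentˡ p p' 𝟘 = refl
  OC-·-independentˡ p p' 𝟙 = refl
  OC-·-independentˡ p p' (act a) = refl
  OC-·-independentˡ p p' (q · r) = refl
  OC-·-independentˡ p p' (q ⊕ r) = refl
  OC-·-independentˡ p p' (r *) = refl
  OC-·-independentˡ p p' (q ∥ r) = refl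

  step-Descent : ∀ {p a p'} → p ─[ a ]→ p' → Descent p p'
  step-OC-≥ : ∀ {p a p'} → p ─[ a ]→ p' → OC p ≥ OC p'
  ·→ʳ-Descent : ∀ (p : Exp A) {q a q'} → q ─[ a ]→ q' → Descent (p · q) q'

  step-OC-≥ t = Descent⇒OC-≥ (step-Descent t)

  ·→ʳ-Descent p {q} t with OC-·-star-or-suc p q
  ... | inj₂ OC-p·q≡1+OC-q = inj₁ (subst (_ <_) (sym OC-p·q≡1+OC-q) (s≤s (step-OC-≥ t)))
  ... | inj₁ (r , refl) with t
  ...   | *→ _ = inj₂ (refl , ·-frame)

  step-Descent act→ = inj₁ (s≤s z≤n)
  step-Descent (⊕→ˡ {p} {q} t) = inj₁ (s≤s (≤-trans (step-OC-≥ t) (m≤m⊔n (OC p) (OC q))))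
  step-Descent (⊕→ʳ {p} {q} t) = inj₁ (s≤s (≤-trans (step-OC-≥ t) (m≤n⊔m (OC q) (OC p))))
  step-Descent (·→ˡ {p} {q} {p' = p'} _) = inj₂ (OC-·-independentˡ p p' q , ·-frame)
  step-Descent (·→ʳ {p} _ t) = ·→ʳ-Descent p t
  step-Descent (*→ _) = inj₁ (s≤s z≤n)
  step-Descent (∥→ˡ _) = inj₂ (refl , ∥-frame)
  step-Descent (∥→ʳ _) = inj₂ (refl , ∥-frame)

  ⟶⁺-Descent : ∀ {p p'} → p ⟶⁺ p' → Descent p p'
  ⟶⁺-Descent [ step t ] = step-Descent t
  ⟶⁺-Descent (step t ∷ steps) = Descent-trans (step-Descent t) (⟶⁺-Descent steps)

lemma25 : {A : Set} → A → (p p' : Exp A) → p ⟶⁺ p' →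
    (OC p ≥ OC p') ×
    (OC p ≡ OC p' →
      (∃[ p₁ ] ∃[ p₁' ] ∃[ q ] (p ≡ p₁ · q × p' ≡ p₁' · q))
      ⊎ (∃[ p₁ ] ∃[ p₂ ] ∃[ p₁' ] ∃[ p₂' ] (p ≡ p₁ ∥ p₂ × p' ≡ p₁' ∥ p₂')))
lemma25 _ p p' steps = Descent⇒OC-≥ descent , λ p≡p' → frame (Descent-OC-≡⇒SameFrame descent p≡p')
  where
    descent : Descent p p'
    descent = ⟶⁺-Descent steps

    frame : ∀ {p p'} → SameFrame p p' →
      (∃[ p₁ ] ∃[ p₁' ] ∃[ q ] (p ≡ p₁ · q × p' ≡ p₁' · q))
      ⊎ (∃[ p₁ ] ∃[ p₂ ] ∃[ p₁' ] ∃[ p₂' ] (p ≡ p₁ ∥ p₂ × p' ≡ p₁' ∥ p₂'))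
    frame ·-frame = inj₁ (_ , _ , _ , refl , refl)
    frame ∥-frame = inj₂ (_ , _ , _ , _ , refl , refl)
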